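{- For every odd integer $r\ge 1$ and every nonnegative integer $n$, $\overline{p}_r(n)=p_e^{>r}(n)$.
   Context: A partition of $n$ is a finite non-increasing sequence of positive integers (parts) summing to $n$. An overpartition of $n$ is a partition of $n$ in which the first occurrence of each part size may be overlined; equivalently a pair $(\lambda,\mu)$ with $\lambda$ a partition into distinct parts (the overlined parts), $\mu$ an ordinary partition (the non-overlined parts), $|\lambda|+|\mu|=n$. $\overline{p}_r(n)$ is the number of overpartitions of $n$ in which the overlined parts are unrestricted (besides being distinct) and every non-overlined part is greater than $r$ and has the same parity as $r+1$. $p_e^{>r}(n)$ is the number of partitions of $n$ in which no even integer less than $r$ appears as a part. -}

module Defs where

open import Data.Bool using (Bool; T; not; _∧_)
open import Data.Nat using (ℕ; _+_; _<_; _>_; _≥_; _%_; _≡ᵇ_; _<ᵇ_)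
open import Data.Nat.ListAction using (sum)
open import Data.List using (List)
open import Data.List.Relation.Unary.All using (All)
open import Data.List.Relation.Unary.Linked using (Linked)
open import Data.Product using (Σ; _×_)
open import Relation.Binary.PropositionalEquality using (_≡_)

IsPartition : ℕ → List ℕ → Set
IsPartition n xs = All (λ x → 0 < x) xs × Linked _≥_ xs × sum xs ≡ n

IsDistinctPartition : ℕ → List ℕ → Set
IsDistinctPartition n xs = All (λ x → 0 < x) xs × Linked _>_ xs × sum xs ≡ n

-- Overpartitions counted by \overline{p}_r(n): pairs (λ , μ) with λ a
-- partition into distinct parts (the overlined parts), μ an ordinary
-- partition (non-overlined parts), |λ| + |μ| = n, and every part of μ is
-- greater than r and has the same parity as r + 1.
OverPartitionR : ℕ → ℕ → Set
OverPartitionR r n =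
  Σ (List ℕ) λ lam → Σ (List ℕ) λ mu →
    IsDistinctPartition (sum lam) lam × IsPartition (sum mu) mu ×
    sum lam + sum mu ≡ n ×
    All (λ x → r < x × x % 2 ≡ (1 + r) % 2) mu

-- x is an even integer less than r (Boolean test, so that the predicate
-- below is proof-irrelevant).
isSmallEven : ℕ → ℕ → Bool
isSmallEven r x = (x % 2 ≡ᵇ 0) ∧ (x <ᵇ r)

PartitionNoSmallEven : ℕ → ℕ → Set
PartitionNoSmallEven r n =
  Σ (List ℕ) λ xs → IsPartition n xs × All (λ x → T (not (isSmallEven r x))) xs

-- Since r is odd, a non-overlined part of an overpartition counted by p̄_r(n) is
-- exactly an even part that is not smaller than r, i.e. an even part allowed in
-- p_e^{>r}(n). So it suffices to trade the overlined (distinct) parts for odd parts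
-- with the same sum, which is Glaisher's bijection: split every even part 2m into
-- m, m until all parts are odd; conversely, merge two equal parts m, m into 2m
-- until all parts are distinct. Multisets of parts are handled as lists up to
-- permutation, and the non-increasing representative is recovered by sorting.
-- Merging inverts splitting because a multiset has a unique decomposition
-- S + 2P with S a set: compare multiplicities modulo 2.
module Submission where

open import Data.Bool using (T; not; true; false)
open import Data.Bool.Properties using (T-∧; T-irrelevant)
open import Data.List using (List; []; _∷_; _++_; [_]; map; filter; length)
open import Data.List.Membership.Propositional using (_∈_)
open import Data.List.Membership.Propositional.Properties using (∈-∃++)
open import Data.List.Properties
  using ( filter-++; filter-accept; filter-reject; filter-none; filter-all; partition-defn
        ; length-++; ++-assoc; ++-identityʳ; map-∘; map-cong; map-id; map-id-local )
open import Data.List.Relation.Binary.Disjoint.Propositional using (Disjoint)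
open import Data.List.Relation.Binary.Permutation.Propositional
  using (_↭_; ↭-refl; ↭-prep; ↭-sym; ↭-trans; ↭-reflexive; ↭⇒↭ₛ; ↭ₛ⇒↭; module PermutationReasoning)
open import Data.List.Relation.Binary.Permutation.Propositional.Properties
  using (filter-↭; ↭-length; shift; All-resp-↭)
  renaming (++⁺ to ↭-++⁺; ++⁺ˡ to ↭-++⁺ˡ; ++⁺ʳ to ↭-++⁺ʳ; map⁺ to ↭-map⁺)
open import Data.List.Relation.Binary.Pointwise using (Pointwise-≡⇒≡)
open import Data.List.Relation.Unary.All as All using (All; []; _∷_)
open import Data.List.Relation.Unary.All.Properties using (++⁺; ++⁻; all-filter; filter⁺; map⁺)
import Data.List.Relation.Unary.AllPairs as AllPairs
open import Data.List.Relation.Unary.Any using (here; there)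
open import Data.List.Relation.Unary.Linked as Linked using (Linked; []; [-]; _∷_)
import Data.List.Relation.Unary.Linked.Properties as Linked
import Data.List.Relation.Unary.Sorted.TotalOrder.Properties as Sorted
open import Data.List.Relation.Unary.Unique.Propositional using (Unique; []; _∷_)
import Data.List.Relation.Unary.Unique.Propositional.Properties as Unique
open import Data.Nat
open import Data.Nat.DivMod
  using (m%n<n; m*n%n≡0; m*n/n≡m; m≡m%n+[m/n]*n; %-distribˡ-+; m/n<m; m≥n⇒m/n>0)
open import Data.Nat.ListAction using (sum)
open import Data.Nat.ListAction.Properties using (sum-++; sum-↭)
open import Data.Nat.Properties
open import Data.Product using (_×_; _,_; proj₁; proj₂; map₁; map₂; uncurry)
open import Data.Unit using (tt)
open import Function using (_∘_; flip)
open import Function.Bundles using (_⇔_; _↔_; mk⇔; mk↔ₛ′; Equivalence)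
open import Relation.Binary.Bundles using (DecTotalOrder)
open import Relation.Binary.Properties.DecTotalOrder ≤-decTotalOrder using (≥-decTotalOrder)
open import Relation.Binary.PropositionalEquality
  using (_≡_; _≢_; refl; sym; trans; cong; cong₂; subst; ≢-sym; setoid; module ≡-Reasoning)
open import Relation.Nullary using (¬_; yes; no; contradiction)
open import Relation.Nullary.Irrelevant using (Irrelevant)
open import Relation.Unary using (Decidable)
open import Relation.Unary.Properties using (∁?)

open import Data.List.Sort ≥-decTotalOrder using (sort; sort-↭; sort-↗)
open import Data.List.Relation.Binary.Permutation.Setoid.Properties (setoid ℕ)
  using (partition-↭; Unique-resp-↭)

open import Defs

count : ℕ → List ℕ → ℕ
count y xs = length (filter (_≟ y) xs)

count-++ : ∀ y xs ys → count y (xs ++ ys) ≡ count y xs + count y ys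
count-++ y xs ys = trans (cong length (filter-++ (_≟ y) xs ys)) (length-++ (filter (_≟ y) xs))

count-↭ : ∀ y {xs ys} → xs ↭ ys → count y xs ≡ count y ys
count-↭ y xs↭ys = ↭-length (filter-↭ (_≟ y) xs↭ys)

count-here : ∀ x xs → count x (x ∷ xs) ≡ suc (count x xs)
count-here x xs = cong length (filter-accept (_≟ x) refl)

count-there : ∀ {x y} xs → x ≢ y → count y (x ∷ xs) ≡ count y xs
count-there xs x≢y = cong length (filter-reject (_≟ _) x≢y)

count-none : ∀ {y} xs → All (_≢ y) xs → count y xs ≡ 0
count-none xs ≢y = cong length (filter-none (_≟ _) ≢y)

count-∷-cancel : ∀ y x xs ys → count y (x ∷ xs) ≡ count y (x ∷ ys) → count y xs ≡ count y ys
count-∷-cancel y x xs ys eq with x ≟ y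
... | yes refl = suc-injective (trans (sym (count-here x xs)) (trans eq (count-here x ys)))
... | no x≢y = trans (sym (count-there xs x≢y)) (trans eq (count-there ys x≢y))

count>0⇒∈ : ∀ {x} ys → 0 < count x ys → x ∈ ys
count>0⇒∈ {x} (y ∷ ys) pos with y ≟ x
... | yes refl = here refl
... | no y≢x = there (count>0⇒∈ ys (subst (0 <_) (count-there ys y≢x) pos))

count⇒↭ : ∀ xs ys → (∀ y → count y xs ≡ count y ys) → xs ↭ ys
count⇒↭ [] [] _ = ↭-refl
count⇒↭ [] (y ∷ ys) eq = contradiction (trans (eq y) (count-here y ys)) 0≢1+n
count⇒↭ (x ∷ xs) ys eq
  with as , bs , refl ← ∈-∃++ (count>0⇒∈ ys (subst (0 <_) (trans (sym (count-here x xs)) (eq x)) z<s)) =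
  begin
    x ∷ xs         <⟨ count⇒↭ xs (as ++ bs) counts ⟩
    x ∷ as ++ bs   ↭⟨ shift x as bs ⟨
    as ++ x ∷ bs   ∎
  where
  open PermutationReasoning
  counts : ∀ y → count y xs ≡ count y (as ++ bs)
  counts y = count-∷-cancel y x xs (as ++ bs) (trans (eq y) (count-↭ y (shift x as bs)))

Unique⇒count≤1 : ∀ y {xs} → Unique xs → count y xs ≤ 1
Unique⇒count≤1 y [] = z≤n
Unique⇒count≤1 y (_∷_ {x} {xs} x∉xs xs!) with x ≟ y
... | yes refl = ≤-reflexive (trans (count-here x xs) (cong suc (count-none xs (All.map (_∘ sym) x∉xs))))
... | no x≢y = subst (_≤ 1) (sym (count-there xs x≢y)) (Unique⇒count≤1 y xs!)

bit+double-injective : ∀ {a b c d} → a ≤ 1 → c ≤ 1 → a + (b + b) ≡ c + (d + d) → a ≡ c × b ≡ d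
bit+double-injective {a} {b} {c} {d} a≤1 c≤1 eq = a≡c , b≡d
  where
  half : ∀ {a} b → a ≤ 1 → ⌊ a + (b + b) /2⌋ ≡ b
  half b z≤n = sym (n≡⌊n+n/2⌋ b)
  half b (s≤s z≤n) = sym (n≡⌈n+n/2⌉ b)
  b≡d : b ≡ d
  b≡d = trans (sym (half b a≤1)) (trans (cong ⌊_/2⌋ eq) (half d c≤1))
  a≡c : a ≡ c
  a≡c = +-cancelʳ-≡ (b + b) a c (subst (λ k → a + (b + b) ≡ c + (k + k)) (sym b≡d) eq)

count-++-twice : ∀ y s p → count y (s ++ p ++ p) ≡ count y s + (count y p + count y p)
count-++-twice y s p = trans (count-++ y s (p ++ p)) (cong (count y s +_) (count-++ y p p))

↭-pairing-unique : ∀ {s p a q} → Unique s → Unique a → s ++ p ++ p ↭ a ++ q ++ q → s ↭ a × p ↭ q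
↭-pairing-unique {s} {p} {a} {q} s! a! perm =
  count⇒↭ s a (proj₁ ∘ counts) , count⇒↭ p q (proj₂ ∘ counts)
  where
  counts : ∀ y → count y s ≡ count y a × count y p ≡ count y q
  counts y = bit+double-injective (Unique⇒count≤1 y s!) (Unique⇒count≤1 y a!)
    (trans (sym (count-++-twice y s p)) (trans (count-↭ y perm) (count-++-twice y a q)))

↭-sorted-unique : ∀ {xs ys} → Linked _≥_ xs → Linked _≥_ ys → xs ↭ ys → xs ≡ ys
↭-sorted-unique xs↘ ys↘ xs↭ys =
  Pointwise-≡⇒≡ (Sorted.↗↭↗⇒≋ (DecTotalOrder.totalOrder ≥-decTotalOrder) xs↘ ys↘ (↭⇒↭ₛ xs↭ys))

sort-≡ : ∀ {xs ys} → Linked _≥_ ys → xs ↭ ys → sort xs ≡ ys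
sort-≡ {xs} ys↘ xs↭ys = ↭-sorted-unique (sort-↗ xs) ys↘ (↭-trans (sort-↭ xs) xs↭ys)

sort-cong : ∀ {xs ys} → xs ↭ ys → sort xs ≡ sort ys
sort-cong {ys = ys} xs↭ys = sort-≡ (sort-↗ ys) (↭-trans xs↭ys (↭-sym (sort-↭ ys)))

All-sort : ∀ {P : ℕ → Set} {xs} → All P xs → All P (sort xs)
All-sort {xs = xs} = All-resp-↭ (↭-sym (sort-↭ xs))

>-Linked⇒Unique : ∀ {xs} → Linked _>_ xs → Unique xs
>-Linked⇒Unique = AllPairs.map >⇒≢ ∘ Linked.Linked⇒AllPairs (flip <-trans)

≥-Linked∧Unique⇒>-Linked : ∀ {xs} → Linked _≥_ xs → Unique xs → Linked _>_ xs
≥-Linked∧Unique⇒>-Linked [] _ = []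
≥-Linked∧Unique⇒>-Linked [-] _ = [-]
≥-Linked∧Unique⇒>-Linked (x≥y ∷ xs↘) ((x≢y ∷ _) ∷ xs!) =
  ≤∧≢⇒< x≥y (≢-sym x≢y) ∷ ≥-Linked∧Unique⇒>-Linked xs↘ xs!

-- On a non-increasing list, a part of multiplicity k contributes ⌊k/2⌋ copies
-- to the pairs and k mod 2 copies to the singles.
pairUp : List ℕ → List ℕ × List ℕ
pairUpFrom : ℕ → List ℕ → List ℕ × List ℕ

pairUp [] = [] , []
pairUp (x ∷ xs) = pairUpFrom x xs

pairUpFrom x [] = [ x ] , []
pairUpFrom x (y ∷ ys) with x ≟ y
... | yes _ = map₂ (x ∷_) (pairUp ys)
... | no _ = map₁ (x ∷_) (pairUpFrom y ys)

singles : List ℕ → List ℕ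
singles xs = proj₁ (pairUp xs)

pairs : List ℕ → List ℕ
pairs xs = proj₂ (pairUp xs)

pairUp-↭ : ∀ xs → singles xs ++ pairs xs ++ pairs xs ↭ xs
pairUpFrom-↭ : ∀ x xs → singles (x ∷ xs) ++ pairs (x ∷ xs) ++ pairs (x ∷ xs) ↭ x ∷ xs

pairUp-↭ [] = ↭-refl
pairUp-↭ (x ∷ xs) = pairUpFrom-↭ x xs

pairUpFrom-↭ x [] = ↭-refl
pairUpFrom-↭ x (y ∷ ys) with x ≟ y
... | no _ = ↭-prep x (pairUpFrom-↭ y ys)
... | yes refl = begin
  s ++ x ∷ p ++ x ∷ p     ↭⟨ shift x s (p ++ x ∷ p) ⟩
  x ∷ s ++ p ++ x ∷ p     ≡⟨ cong (x ∷_) (++-assoc s p (x ∷ p)) ⟨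
  x ∷ (s ++ p) ++ x ∷ p   ↭⟨ ↭-prep x (shift x (s ++ p) p) ⟩
  x ∷ x ∷ (s ++ p) ++ p   ≡⟨ cong (λ zs → x ∷ x ∷ zs) (++-assoc s p p) ⟩
  x ∷ x ∷ s ++ p ++ p     ↭⟨ ↭-prep x (↭-prep x (pairUp-↭ ys)) ⟩
  x ∷ x ∷ ys              ∎
  where
  open PermutationReasoning
  s = singles ys
  p = pairs ys

pairUp-All : ∀ {P : ℕ → Set} {xs} → All P xs → All P (singles xs) × All P (pairs xs)
pairUp-All {xs = xs} pxs with ps , pps ← ++⁻ (singles xs) (All-resp-↭ (↭-sym (pairUp-↭ xs)) pxs) =
  ps , proj₁ (++⁻ (pairs xs) pps)

length-pairUp : ∀ xs → length (singles xs) + (length (pairs xs) + length (pairs xs)) ≡ length xs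
length-pairUp xs =
  trans (cong (length (singles xs) +_) (sym (length-++ (pairs xs))))
        (trans (sym (length-++ (singles xs))) (↭-length (pairUp-↭ xs)))

singles-unique : ∀ {xs} → Linked _≥_ xs → Unique (singles xs)
singlesFrom-unique : ∀ x xs → Linked _≥_ (x ∷ xs) → Unique (singles (x ∷ xs))

singles-unique {[]} _ = []
singles-unique {x ∷ xs} x∷xs↘ = singlesFrom-unique x xs x∷xs↘

singlesFrom-unique x [] _ = [] ∷ []
singlesFrom-unique x (y ∷ ys) (x≥y ∷ y∷ys↘) with x ≟ y
... | yes refl = singles-unique (Linked.tail y∷ys↘)
... | no x≢y = All.map (λ z≤y → >⇒≢ (≤-<-trans z≤y y<x)) singles≤y ∷ singlesFrom-unique y ys y∷ys↘
  where
  y<x : y < x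
  y<x = ≤∧≢⇒< x≥y (≢-sym x≢y)
  singles≤y : All (_≤ y) (singles (y ∷ ys))
  singles≤y = proj₁ (pairUp-All (Linked.Linked⇒All (flip ≤-trans) ≤-refl y∷ys↘))

Odd : ℕ → Set
Odd x = x % 2 ≡ 1

odd? : Decidable Odd
odd? x = x % 2 ≟ 1

odds : List ℕ → List ℕ
odds = filter odd?

evens : List ℕ → List ℕ
evens = filter (∁? odd?)

halves : List ℕ → List ℕ
halves xs = map (_/ 2) (evens xs)

¬odd⇒%2≡0 : ∀ {x} → ¬ Odd x → x % 2 ≡ 0
¬odd⇒%2≡0 {x} ¬odd with x % 2 | m%n<n x 2
... | 0 | _ = refl
... | 1 | _ = contradiction refl ¬odd
... | suc (suc _) | s≤s (s≤s ())

odd⇒>0 : ∀ {x} → Odd x → 0 < x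
odd⇒>0 {suc _} _ = z<s

¬odd-*2 : ∀ x → ¬ Odd (x * 2)
¬odd-*2 x odd = 0≢1+n (trans (sym (m*n%n≡0 x 2)) odd)

*2-/2 : ∀ x → x * 2 / 2 ≡ x
*2-/2 x = m*n/n≡m x 2

/2-*2 : ∀ {x} → ¬ Odd x → x / 2 * 2 ≡ x
/2-*2 {x} ¬odd = sym (trans (m≡m%n+[m/n]*n x 2) (cong (_+ x / 2 * 2) (¬odd⇒%2≡0 {x} ¬odd)))

*2≡+ : ∀ n → n * 2 ≡ n + n
*2≡+ n = trans (*-comm n 2) (cong (n +_) (+-identityʳ n))

halve-bounds : ∀ {f x} → ¬ Odd x → 0 < x × x ≤ suc f → 0 < x / 2 × x / 2 ≤ f
halve-bounds {x = suc zero} ¬odd _ = contradiction refl ¬odd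
halve-bounds {x = x@(suc (suc _))} _ (_ , x≤1+f) =
  m≥n⇒m/n>0 {x} {2} (s≤s (s≤s z≤n)) , ≤-pred (≤-trans (m/n<m x 2 ≤-refl) x≤1+f)

m+m≤1+n⇒m≤n : ∀ {m n} → m + m ≤ suc n → m ≤ n
m+m≤1+n⇒m≤n {zero} _ = z≤n
m+m≤1+n⇒m≤n {suc m} (s≤s m+1+m≤n) = ≤-trans (m≤n+m (suc m) m) m+1+m≤n

map-*2-even : ∀ xs → All (¬_ ∘ Odd) (map (_* 2) xs)
map-*2-even xs = map⁺ (All.universal ¬odd-*2 xs)

map-/2-*2 : ∀ xs → map (_/ 2) (map (_* 2) xs) ≡ xs
map-/2-*2 xs = trans (sym (map-∘ xs)) (trans (map-cong *2-/2 xs) (map-id xs))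

map-*2-halves : ∀ xs → map (_* 2) (halves xs) ≡ evens xs
map-*2-halves xs = trans (sym (map-∘ (evens xs))) (map-id-local (All.map /2-*2 (all-filter (∁? odd?) xs)))

sum-map-*2 : ∀ xs → sum (map (_* 2) xs) ≡ sum xs + sum xs
sum-map-*2 [] = refl
sum-map-*2 (x ∷ xs) = begin
  x * 2 + sum (map (_* 2) xs)  ≡⟨ cong (x * 2 +_) (sum-map-*2 xs) ⟩
  x * 2 + (sum xs + sum xs)    ≡⟨ cong (x * 2 +_) (*2≡+ (sum xs)) ⟨
  x * 2 + sum xs * 2           ≡⟨ *-distribʳ-+ 2 x (sum xs) ⟨
  (x + sum xs) * 2             ≡⟨ *2≡+ (x + sum xs) ⟩
  (x + sum xs) + (x + sum xs)  ∎
  where open ≡-Reasoning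

odds-evens-↭ : ∀ xs → odds xs ++ evens xs ↭ xs
odds-evens-↭ xs =
  ↭-sym (subst (λ (ys , zs) → xs ↭ ys ++ zs) (partition-defn odd? xs) (↭ₛ⇒↭ (partition-↭ odd? xs)))

odds-evens-++ : ∀ {xs ys} → All Odd xs → All (¬_ ∘ Odd) ys → odds (xs ++ ys) ≡ xs × evens (xs ++ ys) ≡ ys
odds-evens-++ {xs} {ys} odd even = odds≡ , evens≡
  where
  odds≡ : odds (xs ++ ys) ≡ xs
  odds≡ = trans (filter-++ odd? xs ys)
                (trans (cong₂ _++_ (filter-all odd? odd) (filter-none odd? even)) (++-identityʳ xs))
  evens≡ : evens (xs ++ ys) ≡ ys
  evens≡ = trans (filter-++ (∁? odd?) xs ys)
                 (cong₂ _++_ (filter-none (∁? odd?) (All.map (λ o ¬o → ¬o o) odd)) (filter-all (∁? odd?) even))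

halves-All : ∀ {P Q : ℕ → Set} → (∀ {x} → ¬ Odd x → P x → Q (x / 2)) → ∀ {xs} → All P xs → All Q (halves xs)
halves-All h {xs} pxs = map⁺ (All.zipWith (uncurry h) (all-filter (∁? odd?) xs , filter⁺ (∁? odd?) pxs))

-- Glaisher's bijection

-- The first argument is fuel: the number of rounds of halving (resp. pairing up).
-- For equal fuel the two maps invert each other, but only enough fuel makes all
-- parts odd (resp. distinct).
splitEvens : ℕ → List ℕ → List ℕ
splitEvens zero xs = xs
splitEvens (suc f) xs = odds xs ++ splitEvens f (halves xs) ++ splitEvens f (halves xs)

mergePairs : ℕ → List ℕ → List ℕ
mergePairs zero xs = xs
mergePairs (suc f) xs = singles (sort xs) ++ map (_* 2) (mergePairs f (pairs (sort xs)))

splitEvens-↭ : ∀ f {xs ys} → xs ↭ ys → splitEvens f xs ↭ splitEvens f ys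
splitEvens-↭ zero xs↭ys = xs↭ys
splitEvens-↭ (suc f) xs↭ys = ↭-++⁺ (filter-↭ odd? xs↭ys) (↭-++⁺ split-halves split-halves)
  where
  split-halves = splitEvens-↭ f (↭-map⁺ (_/ 2) (filter-↭ (∁? odd?) xs↭ys))

mergePairs-↭ : ∀ f {xs ys} → xs ↭ ys → mergePairs f xs ↭ mergePairs f ys
mergePairs-↭ zero xs↭ys = xs↭ys
mergePairs-↭ (suc f) xs↭ys =
  ↭-reflexive (cong (λ zs → singles zs ++ map (_* 2) (mergePairs f (pairs zs))) (sort-cong xs↭ys))

splitEvens-sum : ∀ f xs → sum (splitEvens f xs) ≡ sum xs
splitEvens-sum zero xs = refl
splitEvens-sum (suc f) xs = begin
  sum (odds xs ++ ys ++ ys)            ≡⟨ sum-++ (odds xs) (ys ++ ys) ⟩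
  sum (odds xs) + sum (ys ++ ys)       ≡⟨ cong (sum (odds xs) +_) (sum-++ ys ys) ⟩
  sum (odds xs) + (sum ys + sum ys)    ≡⟨ cong (λ s → sum (odds xs) + (s + s)) (splitEvens-sum f h) ⟩
  sum (odds xs) + (sum h + sum h)      ≡⟨ cong (sum (odds xs) +_) (sum-map-*2 h) ⟨
  sum (odds xs) + sum (map (_* 2) h)   ≡⟨ cong (λ zs → sum (odds xs) + sum zs) (map-*2-halves xs) ⟩
  sum (odds xs) + sum (evens xs)       ≡⟨ sum-++ (odds xs) (evens xs) ⟨
  sum (odds xs ++ evens xs)            ≡⟨ sum-↭ (odds-evens-↭ xs) ⟩
  sum xs                               ∎
  where
  open ≡-Reasoning
  h = halves xs
  ys = splitEvens f h

splitEvens-odd : ∀ f {xs} → All (λ x → 0 < x × x ≤ f) xs → All Odd (splitEvens f xs)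
splitEvens-odd zero [] = []
splitEvens-odd zero ((0<x , x≤0) ∷ _) = contradiction x≤0 (<⇒≱ 0<x)
splitEvens-odd (suc f) {xs} bounds = ++⁺ (all-filter odd? xs) (++⁺ split-halves split-halves)
  where
  split-halves = splitEvens-odd f (halves-All halve-bounds bounds)

mergePairs-positive : ∀ f {xs} → All (0 <_) xs → All (0 <_) (mergePairs f xs)
mergePairs-positive zero pos = pos
mergePairs-positive (suc f) pos with singles-pos , pairs-pos ← pairUp-All (All-sort pos) =
  ++⁺ singles-pos (map⁺ (All.map (*-monoˡ-< 2) (mergePairs-positive f pairs-pos)))

mergePairs-unique : ∀ f {xs} → All Odd xs → length xs ≤ f → Unique (mergePairs f xs)
mergePairs-unique zero {[]} _ _ = []
mergePairs-unique (suc f) {xs} odd len with singles-odd , pairs-odd ← pairUp-All (All-sort odd) =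
  Unique.++⁺ (singles-unique (sort-↗ xs)) (Unique.map⁺ (*-cancelʳ-≡ _ _ 2) merged-unique) disjoint
  where
  ys = sort xs
  pairs-short : length (pairs ys) ≤ f
  pairs-short = m+m≤1+n⇒m≤n (≤-trans (m≤n+m _ (length (singles ys)))
    (subst (_≤ suc f) (sym (trans (length-pairUp ys) (↭-length (sort-↭ xs)))) len))
  merged-unique : Unique (mergePairs f (pairs ys))
  merged-unique = mergePairs-unique f pairs-odd pairs-short
  disjoint : Disjoint (singles ys) (map (_* 2) (mergePairs f (pairs ys)))
  disjoint (v∈singles , v∈doubles) = All.lookup (map-*2-even _) v∈doubles (All.lookup singles-odd v∈singles)

splitEvens-mergePairs : ∀ f {xs} → All Odd xs → splitEvens f (mergePairs f xs) ↭ xs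
splitEvens-mergePairs zero _ = ↭-refl
splitEvens-mergePairs (suc f) {xs} odd with singles-odd , pairs-odd ← pairUp-All (All-sort odd) = begin
  odds ms ++ W ++ W
    ≡⟨ cong₂ (λ os hs → os ++ splitEvens f hs ++ splitEvens f hs) odds-ms halves-ms ⟩
  s ++ splitEvens f M ++ splitEvens f M  ↭⟨ ↭-++⁺ˡ s (↭-++⁺ split-merge split-merge) ⟩
  s ++ p ++ p                            ↭⟨ pairUp-↭ ys ⟩
  ys                                     ↭⟨ sort-↭ xs ⟩
  xs                                     ∎
  where
  open PermutationReasoning
  ys = sort xs
  s = singles ys
  p = pairs ys
  M = mergePairs f p
  ms = s ++ map (_* 2) M
  W = splitEvens f (halves ms)
  parity-split = odds-evens-++ singles-odd (map-*2-even M)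
  odds-ms : odds ms ≡ s
  odds-ms = proj₁ parity-split
  halves-ms : halves ms ≡ M
  halves-ms = trans (cong (map (_/ 2)) (proj₂ parity-split)) (map-/2-*2 M)
  split-merge : splitEvens f M ↭ p
  split-merge = splitEvens-mergePairs f pairs-odd

mergePairs-splitEvens : ∀ f {xs} → Unique xs → mergePairs f (splitEvens f xs) ↭ xs
mergePairs-splitEvens zero _ = ↭-refl
mergePairs-splitEvens (suc f) {xs} xs! = begin
  singles ys ++ map (_* 2) (mergePairs f (pairs ys))  ↭⟨ ↭-++⁺ singles↭odds (↭-map⁺ (_* 2) merge-split) ⟩
  odds xs ++ map (_* 2) h                             ≡⟨ cong (odds xs ++_) (map-*2-halves xs) ⟩
  odds xs ++ evens xs                                 ↭⟨ odds-evens-↭ xs ⟩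
  xs                                                  ∎
  where
  open PermutationReasoning
  h = halves xs
  W = splitEvens f h
  ys = sort (odds xs ++ W ++ W)
  h! : Unique h
  h! = Unique.map⁻ (subst Unique (sym (map-*2-halves xs)) (Unique.filter⁺ (∁? odd?) xs!))
  pairing : singles ys ↭ odds xs × pairs ys ↭ W
  pairing = ↭-pairing-unique (singles-unique (sort-↗ _)) (Unique.filter⁺ odd? xs!)
    (↭-trans (pairUp-↭ ys) (sort-↭ _))
  singles↭odds = proj₁ pairing
  merge-split : mergePairs f (pairs ys) ↭ h
  merge-split = ↭-trans (mergePairs-↭ f (proj₂ pairing)) (mergePairs-splitEvens f h!)

∈⇒≤sum : ∀ {x xs} → x ∈ xs → x ≤ sum xs
∈⇒≤sum {xs = y ∷ ys} (here refl) = m≤m+n y (sum ys)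
∈⇒≤sum {xs = y ∷ ys} (there x∈ys) = ≤-trans (∈⇒≤sum x∈ys) (m≤n+m (sum ys) y)

length≤sum : ∀ {xs} → All (0 <_) xs → length xs ≤ sum xs
length≤sum [] = z≤n
length≤sum (0<x ∷ pos) = +-mono-≤ 0<x (length≤sum pos)

glaisher : List ℕ → List ℕ
glaisher xs = splitEvens (sum xs) xs

glaisher⁻¹ : List ℕ → List ℕ
glaisher⁻¹ xs = mergePairs (sum xs) xs

glaisher-sum : ∀ xs → sum (glaisher xs) ≡ sum xs
glaisher-sum xs = splitEvens-sum (sum xs) xs

glaisher⁻¹-sum : ∀ {xs} → All Odd xs → sum (glaisher⁻¹ xs) ≡ sum xs
glaisher⁻¹-sum {xs} odd = trans (sym (splitEvens-sum (sum xs) _)) (sum-↭ (splitEvens-mergePairs (sum xs) odd))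

glaisher-odd : ∀ {xs} → All (0 <_) xs → All Odd (glaisher xs)
glaisher-odd {xs} pos = splitEvens-odd (sum xs) (All.zip (pos , All.tabulate ∈⇒≤sum))

glaisher⁻¹-positive : ∀ {xs} → All Odd xs → All (0 <_) (glaisher⁻¹ xs)
glaisher⁻¹-positive {xs} odd = mergePairs-positive (sum xs) (All.map odd⇒>0 odd)

glaisher⁻¹-unique : ∀ {xs} → All Odd xs → Unique (glaisher⁻¹ xs)
glaisher⁻¹-unique {xs} odd = mergePairs-unique (sum xs) odd (length≤sum (All.map odd⇒>0 odd))

glaisher-↭ : ∀ {xs ys} → xs ↭ ys → glaisher xs ↭ glaisher ys
glaisher-↭ {xs} xs↭ys =
  subst (λ f → glaisher xs ↭ splitEvens f _) (sum-↭ xs↭ys) (splitEvens-↭ (sum xs) xs↭ys)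

glaisher⁻¹-↭ : ∀ {xs ys} → xs ↭ ys → glaisher⁻¹ xs ↭ glaisher⁻¹ ys
glaisher⁻¹-↭ {xs} xs↭ys =
  subst (λ f → glaisher⁻¹ xs ↭ mergePairs f _) (sum-↭ xs↭ys) (mergePairs-↭ (sum xs) xs↭ys)

glaisher⁻¹-glaisher : ∀ {xs} → Unique xs → glaisher⁻¹ (glaisher xs) ↭ xs
glaisher⁻¹-glaisher {xs} xs! =
  subst (λ f → mergePairs f (glaisher xs) ↭ xs) (sym (glaisher-sum xs)) (mergePairs-splitEvens (sum xs) xs!)

glaisher-glaisher⁻¹ : ∀ {xs} → All Odd xs → glaisher (glaisher⁻¹ xs) ↭ xs
glaisher-glaisher⁻¹ {xs} odd = subst (λ f → splitEvens f (glaisher⁻¹ xs) ↭ xs) (sym (glaisher⁻¹-sum odd))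
  (splitEvens-mergePairs (sum xs) odd)

×-irrelevant : ∀ {A B : Set} → Irrelevant A → Irrelevant B → Irrelevant (A × B)
×-irrelevant irrA irrB (a , b) (a′ , b′) = cong₂ _,_ (irrA a a′) (irrB b b′)

IsPartition-irrelevant : ∀ n xs → Irrelevant (IsPartition n xs)
IsPartition-irrelevant n xs =
  ×-irrelevant (All.irrelevant ≤-irrelevant) (×-irrelevant (Linked.irrelevant ≤-irrelevant) ≡-irrelevant)

IsDistinctPartition-irrelevant : ∀ n xs → Irrelevant (IsDistinctPartition n xs)
IsDistinctPartition-irrelevant n xs =
  ×-irrelevant (All.irrelevant ≤-irrelevant) (×-irrelevant (Linked.irrelevant <-irrelevant) ≡-irrelevant)

partition-≡ : ∀ {r n} {p q : PartitionNoSmallEven r n} → proj₁ p ≡ proj₁ q → p ≡ q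
partition-≡ {p = xs , xs-ok} {.xs , xs-ok′} refl =
  cong (xs ,_) (×-irrelevant (IsPartition-irrelevant _ xs) (All.irrelevant T-irrelevant) xs-ok xs-ok′)

overpartition-≡ : ∀ {r n} {p q : OverPartitionR r n} →
  proj₁ p ≡ proj₁ q → proj₁ (proj₂ p) ≡ proj₁ (proj₂ q) → p ≡ q
overpartition-≡ {p = lam , mu , ok} {.lam , .mu , ok′} refl refl =
  cong (λ ok → lam , mu , ok)
    (×-irrelevant (IsDistinctPartition-irrelevant _ lam)
      (×-irrelevant (IsPartition-irrelevant _ mu)
        (×-irrelevant ≡-irrelevant (All.irrelevant (×-irrelevant <-irrelevant ≡-irrelevant)))) ok ok′)

T-not⇔¬T : ∀ b → T (not b) ⇔ (¬ T b)
T-not⇔¬T false = mk⇔ (λ _ ()) (λ _ → tt)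
T-not⇔¬T true = mk⇔ (λ ()) (λ ¬t → ¬t tt)

notSmallEven⇔ : ∀ r x → T (not (isSmallEven r x)) ⇔ (¬ (x % 2 ≡ 0 × x < r))
notSmallEven⇔ r x = mk⇔
  (λ t (even , x<r) → Equivalence.to (T-not⇔¬T _) t (Equivalence.from T-∧ (≡⇒≡ᵇ _ 0 even , <⇒<ᵇ x<r)))
  (λ ¬small → Equivalence.from (T-not⇔¬T _) λ t →
     let even , x<r = Equivalence.to T-∧ t in ¬small (≡ᵇ⇒≡ _ 0 even , <ᵇ⇒< x r x<r))

module Correspondence (r n : ℕ) (r-odd : Odd r) where

  [1+r]%2≡0 : (1 + r) % 2 ≡ 0
  [1+r]%2≡0 = trans (%-distribˡ-+ 1 r 2) (cong (λ b → (1 + b) % 2) r-odd)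

  odd⇒notSmallEven : ∀ {x} → Odd x → T (not (isSmallEven r x))
  odd⇒notSmallEven {x} odd =
    Equivalence.from (notSmallEven⇔ r x) (λ (even , _) → 0≢1+n (trans (sym even) odd))

  nonOverlinedPart⇔ : ∀ x → (r < x × x % 2 ≡ (1 + r) % 2) ⇔ (¬ Odd x × T (not (isSmallEven r x)))
  nonOverlinedPart⇔ x = mk⇔
    (λ (r<x , x≡1+r) → (λ odd → 0≢1+n (trans (sym (trans x≡1+r [1+r]%2≡0)) odd)) ,
                       Equivalence.from (notSmallEven⇔ r x) (λ (_ , x<r) → <-asym r<x x<r))
    (λ (¬odd , notSmall) → ≤∧≢⇒< (r≤x ¬odd notSmall) (λ r≡x → ¬odd (subst Odd r≡x r-odd)) ,
                           trans (¬odd⇒%2≡0 {x} ¬odd) (sym [1+r]%2≡0))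
    where
    r≤x : ¬ Odd x → T (not (isSmallEven r x)) → r ≤ x
    r≤x ¬odd notSmall = ≮⇒≥ (λ x<r → Equivalence.to (notSmallEven⇔ r x) notSmall (¬odd⇒%2≡0 {x} ¬odd , x<r))

  toPartition : OverPartitionR r n → PartitionNoSmallEven r n
  toPartition (lam , mu , (lam>0 , _ , _) , (mu>0 , _ , _) , sum≡n , mu-ok) =
    sort parts , (All-sort parts>0 , sort-↗ parts , sum-sort) , All-sort parts-notSmallEven
    where
    parts = glaisher lam ++ mu
    glaisher-lam-odd = glaisher-odd lam>0
    parts>0 = ++⁺ (All.map odd⇒>0 glaisher-lam-odd) mu>0
    parts-notSmallEven = ++⁺ (All.map odd⇒notSmallEven glaisher-lam-odd)
                             (All.map (λ {x} → proj₂ ∘ Equivalence.to (nonOverlinedPart⇔ x)) mu-ok)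
    sum-sort : sum (sort parts) ≡ n
    sum-sort = begin
      sum (sort parts)             ≡⟨ sum-↭ (sort-↭ parts) ⟩
      sum (glaisher lam ++ mu)     ≡⟨ sum-++ (glaisher lam) mu ⟩
      sum (glaisher lam) + sum mu  ≡⟨ cong (_+ sum mu) (glaisher-sum lam) ⟩
      sum lam + sum mu             ≡⟨ sum≡n ⟩
      n                            ∎
      where open ≡-Reasoning

  toOverpartition : PartitionNoSmallEven r n → OverPartitionR r n
  toOverpartition (xs , (xs>0 , xs↘ , sum≡n) , notSmallEven) =
    lam , mu , (lam>0 , lam↘ , refl) , (mu>0 , mu↘ , refl) , sum-lam+mu , mu-ok
    where
    odds-odd = all-filter odd? xs
    lam = sort (glaisher⁻¹ (odds xs))
    mu = evens xs
    lam>0 = All-sort (glaisher⁻¹-positive odds-odd)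
    lam↘ = ≥-Linked∧Unique⇒>-Linked (sort-↗ _)
      (Unique-resp-↭ (↭⇒↭ₛ (↭-sym (sort-↭ _))) (glaisher⁻¹-unique odds-odd))
    mu>0 = filter⁺ (∁? odd?) xs>0
    mu↘ = Linked.filter⁺ (∁? odd?) (flip ≤-trans) xs↘
    mu-ok = All.map (λ {x} → Equivalence.from (nonOverlinedPart⇔ x))
                    (All.zip (all-filter (∁? odd?) xs , filter⁺ (∁? odd?) notSmallEven))
    sum-lam+mu : sum lam + sum mu ≡ n
    sum-lam+mu = begin
      sum lam + sum mu             ≡⟨ cong (_+ sum mu) (trans (sum-↭ (sort-↭ _)) (glaisher⁻¹-sum odds-odd)) ⟩
      sum (odds xs) + sum mu       ≡⟨ sum-++ (odds xs) mu ⟨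
      sum (odds xs ++ evens xs)    ≡⟨ sum-↭ (odds-evens-↭ xs) ⟩
      sum xs                       ≡⟨ sum≡n ⟩
      n                            ∎
      where open ≡-Reasoning

  toPartition∘toOverpartition : ∀ p → toPartition (toOverpartition p) ≡ p
  toPartition∘toOverpartition (xs , (_ , xs↘ , _) , _) = partition-≡ {r} {n} (sort-≡ xs↘ (begin
    glaisher (sort (glaisher⁻¹ (odds xs))) ++ evens xs  ↭⟨ ↭-++⁺ʳ (evens xs) (glaisher-↭ (sort-↭ _)) ⟩
    glaisher (glaisher⁻¹ (odds xs)) ++ evens xs         ↭⟨ ↭-++⁺ʳ (evens xs) (glaisher-glaisher⁻¹ (all-filter odd? xs)) ⟩
    odds xs ++ evens xs                                 ↭⟨ odds-evens-↭ xs ⟩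
    xs                                                  ∎))
    where open PermutationReasoning

  toOverpartition∘toPartition : ∀ q → toOverpartition (toPartition q) ≡ q
  toOverpartition∘toPartition (lam , mu , (lam>0 , lam↘ , _) , (_ , mu↘ , _) , _ , mu-ok) =
    overpartition-≡ {r} {n} (sort-≡ (Linked.map <⇒≤ lam↘) lam-perm)
      (↭-sorted-unique (Linked.filter⁺ (∁? odd?) (flip ≤-trans) (sort-↗ parts)) mu↘ mu-perm)
    where
    parts = glaisher lam ++ mu
    parity-split = odds-evens-++ (glaisher-odd lam>0)
      (All.map (λ {x} → proj₁ ∘ Equivalence.to (nonOverlinedPart⇔ x)) mu-ok)
    lam-perm : glaisher⁻¹ (odds (sort parts)) ↭ lam
    lam-perm = begin
      glaisher⁻¹ (odds (sort parts))  ↭⟨ glaisher⁻¹-↭ (filter-↭ odd? (sort-↭ parts)) ⟩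
      glaisher⁻¹ (odds parts)         ≡⟨ cong glaisher⁻¹ (proj₁ parity-split) ⟩
      glaisher⁻¹ (glaisher lam)       ↭⟨ glaisher⁻¹-glaisher (>-Linked⇒Unique lam↘) ⟩
      lam                             ∎
      where open PermutationReasoning
    mu-perm : evens (sort parts) ↭ mu
    mu-perm = ↭-trans (filter-↭ (∁? odd?) (sort-↭ parts)) (↭-reflexive (proj₂ parity-split))

proposition2p5 : (r n : ℕ) → 1 ≤ r → r % 2 ≡ 1 →
    OverPartitionR r n ↔ PartitionNoSmallEven r n
-- The hypothesis 1 ≤ r is implied by r % 2 ≡ 1.
proposition2p5 r n _ r-odd =
  mk↔ₛ′ toPartition toOverpartition toPartition∘toOverpartition toOverpartition∘toPartition
  where open Correspondence r n r-odd
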